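{- For every agent $i$ and all formulas $\phi,\psi$ of $\mathbf{LUT}$, $\vDash U_i(\phi\to\psi)\to(U_i\phi\to U_i\psi)$.
   Context: Let $\mathbf{P}$ be a countably infinite set of propositional variables and $\mathbf{I}$ a finite set of agents. The language $\mathbf{LUT}$ is given by $\phi::= p\mid\neg\phi\mid(\phi\land\phi)\mid K_i\phi\mid[\phi]\phi\mid U_i\phi$ ($p\in\mathbf{P}$, $i\in\mathbf{I}$); $\mathbf{EL}$ is the fragment without $[\cdot]$ and $U_i$. A model is $\mathcal{M}=\langle S,\{R_i\}_{i\in\mathbf{I}},V\rangle$ with $S\neq\emptyset$, each $R_i$ a reflexive relation on $S$, $V:\mathbf{P}\to2^S$. Truth: $p$ true at $s$ iff $s\in V(p)$; Boolean clauses as usual; $\mathcal{M},s\vDash K_i\phi$ iff $\phi$ holds at all $t$ with $sR_it$; $\mathcal{M},s\vDash[\psi]\phi$ iff ($\mathcal{M},s\vDash\psi$ implies $\mathcal{M}|_\psi,s\vDash\phi$), with $\mathcal{M}|_\psi$ the restriction of $\mathcal{M}$ to the states where $\psi$ is true; $\mathcal{M},s\vDash U_i\phi$ iff $\mathcal{M},s\vDash\phi$ and for all $\psi\in\mathbf{EL}$, $\mathcal{M},s\vDash[\psi]\neg K_i\phi$. $\vDash\phi$ means $\phi$ is true at every state of every model. -}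

module Defs where

open import Data.Nat using (ℕ)
open import Data.Fin using (Fin)
open import Data.Bool using (Bool; true)
open import Data.Product using (Σ; _×_; _,_; proj₁)
open import Relation.Binary.PropositionalEquality using (_≡_)
open import Relation.Nullary using (¬_)

data LUT (n : ℕ) : Set where
  var : ℕ → LUT n
  neg : LUT n → LUT n
  and : LUT n → LUT n → LUT n
  K   : Fin n → LUT n → LUT n
  ann : LUT n → LUT n → LUT n      -- ann ψ φ  is  [ψ]φ
  U   : Fin n → LUT n → LUT n

data EL (n : ℕ) : Set where
  var : ℕ → EL n
  neg : EL n → EL n
  and : EL n → EL n → EL n
  K   : Fin n → EL n → EL n

_⇒_ : ∀ {n} → LUT n → LUT n → LUT n
φ ⇒ ψ = neg (and φ (neg ψ))
infixr 5 _⇒_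

record Model (n : ℕ) : Set₁ where
  field
    S    : Set
    R    : Fin n → S → S → Set
    reflR : ∀ i s → R i s s
    V    : ℕ → S → Bool
open Model public

restrict : ∀ {n} (M : Model n) → (S M → Set) → Model n
restrict M P = record
  { S = Σ (S M) P
  ; R = λ i s t → R M i (proj₁ s) (proj₁ t)
  ; reflR = λ i s → reflR M i (proj₁ s)
  ; V = λ p s → V M p (proj₁ s)
  }

ELsat : ∀ {n} (M : Model n) → S M → EL n → Set
ELsat M s (var p)   = V M p s ≡ true
ELsat M s (neg φ)   = ¬ ELsat M s φ
ELsat M s (and φ ψ) = ELsat M s φ × ELsat M s ψ
ELsat M s (K i φ)   = ∀ t → R M i s t → ELsat M t φ

sat : ∀ {n} (M : Model n) → S M → LUT n → Set
sat M s (var p)   = V M p s ≡ true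
sat M s (neg φ)   = ¬ sat M s φ
sat M s (and φ ψ) = sat M s φ × sat M s ψ
sat M s (K i φ)   = ∀ t → R M i s t → sat M t φ
sat M s (ann ψ φ) = (h : sat M s ψ) → sat (restrict M (λ t → sat M t ψ)) (s , h) φ
-- U_i φ: φ holds, and for every EL formula χ, M,s ⊨ [χ]¬K_i φ
sat M s (U i φ)   =
  sat M s φ ×
  (∀ (χ : EL _) (h : ELsat M s χ) →
     ¬ (∀ t → R (restrict M (λ u → ELsat M u χ)) i (s , h) t
              → sat (restrict M (λ u → ELsat M u χ)) t φ))

Valid : ∀ {n} → LUT n → Set₁
Valid {n} φ = ∀ (M : Model n) (s : S M) → sat M s φ

{-# OPTIONS --safe #-}
-- For the unknowability part of U_i ψ,
-- note that ψ entails φ ⇒ ψ in every model, so whenever an announcement would make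
-- agent i know ψ it would also make i know φ ⇒ ψ, contradicting U_i (φ ⇒ ψ).
-- The premise U_i φ is only used for the truth of φ. Since φ ⇒ ψ abbreviates ¬(φ ∧ ¬ψ),
-- implications are introduced and eliminated under a double negation.
module Submission where

open import Defs
open import Data.Nat using (ℕ)
open import Data.Fin using (Fin)
open import Data.Product using (_,_)
open import Relation.Nullary using (¬_)
open import Relation.Nullary.Negation using (¬¬-map)

module _ {n : ℕ} where

  NeverKnown : (M : Model n) → S M → Fin n → LUT n → Set
  NeverKnown M s i φ =
    ∀ (χ : EL n) (h : ELsat M s χ) →
      ¬ (∀ t → R (restrict M (λ u → ELsat M u χ)) i (s , h) t
               → sat (restrict M (λ u → ELsat M u χ)) t φ)

  Entails : LUT n → LUT n → Set₁
  Entails φ ψ = ∀ (M : Model n) t → sat M t φ → sat M t ψ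

  NeverKnown-antitone : ∀ (M : Model n) s i (φ ψ : LUT n) → Entails ψ φ →
                        NeverKnown M s i φ → NeverKnown M s i ψ
  NeverKnown-antitone M s i φ ψ ψ⊨φ never χ h knownψ =
    never χ h (λ t r → ψ⊨φ (restrict M (λ u → ELsat M u χ)) t (knownψ t r))

  ⇒-intro : ∀ (M : Model n) s (φ ψ : LUT n) →
            (sat M s φ → ¬ ¬ sat M s ψ) → sat M s (φ ⇒ ψ)
  ⇒-intro M s φ ψ f (φs , ¬ψs) = f φs ¬ψs

  ⇒-elim : ∀ (M : Model n) s (φ ψ : LUT n) →
           sat M s (φ ⇒ ψ) → sat M s φ → ¬ ¬ sat M s ψ
  ⇒-elim M s φ ψ φ⇒ψ φs ¬ψs = φ⇒ψ (φs , ¬ψs)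

  ⇒-weaken : ∀ (φ ψ : LUT n) → Entails ψ (φ ⇒ ψ)
  ⇒-weaken φ ψ M t ψt = ⇒-intro M t φ ψ (λ _ ¬ψt → ¬ψt ψt)

  U-modus-ponens : ∀ (M : Model n) s i (φ ψ : LUT n) →
                   sat M s (U i (φ ⇒ ψ)) → sat M s (U i φ) → ¬ ¬ sat M s (U i ψ)
  U-modus-ponens M s i φ ψ (φ⇒ψs , never[φ⇒ψ]) (φs , _) =
    ¬¬-map (λ ψs → ψs , NeverKnown-antitone M s i (φ ⇒ ψ) ψ (⇒-weaken φ ψ) never[φ⇒ψ])
           (⇒-elim M s φ ψ φ⇒ψs φs)

mainTheorem3 : (n : ℕ) (i : Fin n) (φ ψ : LUT n) →
    Valid (U i (φ ⇒ ψ) ⇒ (U i φ ⇒ U i ψ))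
mainTheorem3 n i φ ψ M s =
  ⇒-intro M s (U i (φ ⇒ ψ)) (U i φ ⇒ U i ψ) λ U[φ⇒ψ] ¬U[φ]⇒U[ψ] →
    ¬U[φ]⇒U[ψ] (⇒-intro M s (U i φ) (U i ψ) (U-modus-ponens M s i φ ψ U[φ⇒ψ]))
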